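{- Let $P$ be a poset on $\{1,\ldots,n\}$, let $J$ be a connected order ideal of $P$, and let $C$ be a connected subgraph of $G_P$ such that $J$ is not adjacent to any vertex of $C$. If some vertex $J_a$ of $C$ satisfies $J_a\subsetneq J$, then $J_b\subsetneq J$ for every vertex $J_b$ of $C$.
   Context: An order ideal of $P$ is a subset $J$ with $i\in J$, $j\le_P i\Rightarrow j\in J$; a nonempty order ideal is connected if the Hasse diagram of $P$ restricted to it is connected. Sets $A,B$ intersect nontrivially if $A\cap B\ne\emptyset$, $A\not\subseteq B$, $B\not\subseteq A$. $G_P$ is the simple graph whose vertices are the connected order ideals of $P$, adjacent iff they intersect nontrivially. -}

module Defs where

open import Level using (0ℓ)
open import Data.Nat using (ℕ)
open import Data.Fin using (Fin)
open import Data.Fin.Subset using (Subset; _∈_; _⊆_; _∩_; Nonempty)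
open import Data.Product using (Σ; ∃; _×_)
open import Data.Sum using (_⊎_)
open import Relation.Nullary using (¬_)
open import Relation.Binary using (Rel; IsPartialOrder)
open import Relation.Binary.PropositionalEquality using (_≡_; _≢_)

record Poset (n : ℕ) : Set₁ where
  field
    _≤P_      : Rel (Fin n) 0ℓ
    isPartialOrder : IsPartialOrder _≡_ _≤P_

module _ {n : ℕ} (P : Poset n) where
  open Poset P

  _<P_ : Fin n → Fin n → Set
  i <P j = i ≤P j × i ≢ j

  Covers : Fin n → Fin n → Set
  Covers i j = i <P j × ¬ (∃ λ k → i <P k × k <P j)

  HasseAdj : Fin n → Fin n → Set
  HasseAdj i j = Covers i j ⊎ Covers j i

  IsOrderIdeal : Subset n → Set
  IsOrderIdeal J = ∀ {i j} → i ∈ J → j ≤P i → j ∈ J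

  data HassePath (J : Subset n) : Fin n → Fin n → Set where
    here : ∀ {i} → i ∈ J → HassePath J i i
    step : ∀ {i j k} → i ∈ J → HasseAdj i j → HassePath J j k → HassePath J i k

  IsConnectedOrderIdeal : Subset n → Set
  IsConnectedOrderIdeal J =
    IsOrderIdeal J × Nonempty J × (∀ {i j} → i ∈ J → j ∈ J → HassePath J i j)

IntersectNontrivially : {n : ℕ} → Subset n → Subset n → Set
IntersectNontrivially A B = Nonempty (A ∩ B) × ¬ (A ⊆ B) × ¬ (B ⊆ A)

module _ {n : ℕ} (P : Poset n) where

  IsVertex : Subset n → Set
  IsVertex = IsConnectedOrderIdeal P

  GAdj : Subset n → Subset n → Set
  GAdj A B = IsVertex A × IsVertex B × IntersectNontrivially A B

  data GPath (C : Subset n → Set) : Subset n → Subset n → Set where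
    here : ∀ {A} → C A → GPath C A A
    step : ∀ {A B D} → C A → GAdj A B → GPath C B D → GPath C A D

  -- a connected subgraph of G_P, given by its vertex set C (a predicate on subsets):
  -- every member is a vertex of G_P and any two members are joined by a path in G_P inside C
  IsConnectedSubgraph : (Subset n → Set) → Set
  IsConnectedSubgraph C =
    (∀ {A} → C A → IsVertex A) × (∀ {A B} → C A → C B → GPath C A B)

-- If A ⊊ J meets B nontrivially, then B cannot contain J (it would contain A), and J ∩ B ⊇ A ∩ B
-- is nonempty; so unless J and B meet nontrivially, B ⊊ J. Since J is adjacent to no vertex of C,
-- being strictly below J therefore propagates along the edges of C, and C is connected.
module Submission where

open import Defs
open import Data.Nat using (ℕ)
open import Data.Fin.Subset using (Subset; _⊂_; _⊈_; _∈_; _∉_)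
open import Data.Fin.Subset.Properties using (_⊆?_; _∈?_; x∈p∩q⁺; x∈p∩q⁻)
open import Data.Fin.Properties using (¬∀⟶∃¬)
open import Data.Product using (∃; _×_; _,_)
open import Relation.Nullary using (¬_; yes; no; contradiction)
open import Relation.Nullary.Decidable using (_→-dec_)

⊈⇒∃∈∉ : ∀ {n} {p q : Subset n} → p ⊈ q → ∃ λ x → x ∈ p × x ∉ q
⊈⇒∃∈∉ {n} {p} {q} p⊈q
  with ¬∀⟶∃¬ n (λ x → x ∈ p → x ∈ q) (λ x → (x ∈? p) →-dec (x ∈? q)) (λ p⊆q → p⊈q (p⊆q _))
... | x , x∈p⇏x∈q with x ∈? p
...   | yes x∈p = x , x∈p , λ x∈q → x∈p⇏x∈q (λ _ → x∈q)
...   | no  x∉p = contradiction (λ x∈p → contradiction x∈p x∉p) x∈p⇏x∈q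

⊂-meeting-nontrivially : ∀ {n} {A B J : Subset n} →
  A ⊂ J → IntersectNontrivially A B → ¬ IntersectNontrivially J B → B ⊂ J
⊂-meeting-nontrivially {A = A} {B} {J} (A⊆J , _) ((x , x∈A∩B) , A⊈B , _) J≁B
  with J ⊆? B | B ⊆? J
... | yes J⊆B | _       = contradiction (λ {_} x∈A → J⊆B (A⊆J x∈A)) A⊈B
... | no  J⊈B | yes B⊆J = B⊆J , ⊈⇒∃∈∉ J⊈B
... | no  J⊈B | no  B⊈J with x∈p∩q⁻ A B x∈A∩B
...   | x∈A , x∈B = contradiction ((x , x∈p∩q⁺ (A⊆J x∈A , x∈B)) , J⊈B , B⊈J) J≁B

module _ {n : ℕ} (P : Poset n) {C : Subset n → Set} where

  GPath-source : ∀ {A B} → GPath P C A B → C A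
  GPath-source (here c)     = c
  GPath-source (step c _ _) = c

  GPath-⊂-preserved : ∀ {J} → IsVertex P J → (∀ {A} → C A → ¬ GAdj P J A) →
    ∀ {A B} → GPath P C A B → A ⊂ J → B ⊂ J
  GPath-⊂-preserved J-vertex J≁C (here _) A⊂J = A⊂J
  GPath-⊂-preserved J-vertex J≁C (step _ (_ , A′-vertex , A≬A′) path) A⊂J =
    GPath-⊂-preserved J-vertex J≁C path
      (⊂-meeting-nontrivially A⊂J A≬A′
        (λ J≬A′ → J≁C (GPath-source path) (J-vertex , A′-vertex , J≬A′)))

lemma3p2 : (n : ℕ) (P : Poset n) (J : Subset n) (C : Subset n → Set) →
    IsConnectedOrderIdeal P J →
    IsConnectedSubgraph P C →
    (∀ {A} → C A → ¬ GAdj P J A) →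
    ∀ {Ja} → C Ja → Ja ⊂ J →
    ∀ {Jb} → C Jb → Jb ⊂ J
lemma3p2 n P J C J-vertex (_ , C-connected) J≁C Ja∈C Ja⊂J Jb∈C =
  GPath-⊂-preserved P J-vertex J≁C (C-connected Ja∈C Jb∈C) Ja⊂J
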